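{- The following two-variable equations do not have finite satisfiability gap in the class of Heyting algebras: (1) $((x\to y)\to x)\to x=\top$; (2) $(\neg x\to\neg y)\to(y\to x)=\top$; (3) $(\neg x\to y)\to((x\to y)\to y)=\top$.
   Context: $\neg x$ abbreviates $x\to\bot$. For a finite Heyting algebra $H$ and an equation $\varphi(x,y)$, $\mathrm{ds}_H(\varphi)=|\{(a,b)\in H^2 : H\models\varphi(a,b)\}|/|H|^2$. An equation has finite satisfiability gap if there is $\varepsilon>0$ such that for every finite Heyting algebra $H$, either $\mathrm{ds}_H=1$ or $\mathrm{ds}_H\le1-\varepsilon$.
   Formalization: The constant ε in the definition of finite satisfiability gap is taken in the positive rationals. -}

module Defs where

open import Level using (0ℓ)
open import Data.Nat using (ℕ; _+_; _*_; _≤_; _<_)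
open import Data.Fin using (Fin; _≟_)
open import Data.Product using (Σ; _×_; _,_)
open import Data.Sum using (_⊎_)
open import Data.List using (List; length; filter; allFin; cartesianProduct)
open import Relation.Binary.PropositionalEquality using (_≡_) renaming (setoid to ≡-setoid)
open import Relation.Binary.Lattice.Bundles using (HeytingAlgebra)
open import Function.Bundles using (Inverse)

record FiniteHeytingAlgebra : Set₁ where
  field
    heyting : HeytingAlgebra 0ℓ 0ℓ 0ℓ
    size : ℕ
    enum : Inverse (≡-setoid (Fin size)) (HeytingAlgebra.setoid heyting)
  open HeytingAlgebra heyting public

-- A two-variable equation  t(x,y) = ⊤,  given by its left-hand term t,
-- interpreted uniformly in every Heyting algebra.
Equation : Set₁
Equation = (H : HeytingAlgebra 0ℓ 0ℓ 0ℓ) →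
           HeytingAlgebra.Carrier H → HeytingAlgebra.Carrier H → HeytingAlgebra.Carrier H

-- Pairs are enumerated via
-- the bijection; t(a,b) ≈ ⊤ is tested as  from (t(a,b)) ≡ from ⊤, which is
-- equivalent since `from` is a setoid bijection.
satCount : Equation → FiniteHeytingAlgebra → ℕ
satCount t H =
  length (filter (λ { (i , j) → from (t heyting (to i) (to j)) ≟ from ⊤ })
                 (cartesianProduct (allFin size) (allFin size)))
  where
  open FiniteHeytingAlgebra H
  open Inverse enum

-- Finite satisfiability gap: there is a rational ε = p/q > 0 such that for
-- every finite Heyting algebra H, either ds_H = 1, i.e. satCount = |H|²,
-- or ds_H ≤ 1 - ε, i.e. q·satCount + p·|H|² ≤ q·|H|²  (cleared denominators).
HasFiniteSatGap : Equation → Set₁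
HasFiniteSatGap t =
  Σ ℕ λ p → Σ ℕ λ q → 0 < p × 0 < q ×
    ((H : FiniteHeytingAlgebra) →
      let n = FiniteHeytingAlgebra.size H in
      satCount t H ≡ n * n ⊎ q * satCount t H + p * (n * n) ≤ q * (n * n))

neg : (H : HeytingAlgebra 0ℓ 0ℓ 0ℓ) → HeytingAlgebra.Carrier H → HeytingAlgebra.Carrier H
neg H x = x ⇨ ⊥ where open HeytingAlgebra H

peirce : Equation
peirce H x y = ((x ⇨ y) ⇨ x) ⇨ x where open HeytingAlgebra H

contraposition : Equation
contraposition H x y = (neg H x ⇨ neg H y) ⇨ (y ⇨ x) where open HeytingAlgebra H

casesEq : Equation
casesEq H x y = (neg H x ⇨ y) ⇨ ((x ⇨ y) ⇨ y) where open HeytingAlgebra H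

-- Adjoin a new top ⊤⁺ to the Boolean algebra 2ⁿ of subsets of an n-element set, above its old
-- top ↑⊤.  Collapsing ⊤⁺ onto ↑⊤ is a Heyting morphism onto 2ⁿ, where the three equations are
-- classical tautologies, so every value t(x,y) is ⊤⁺ or ↑⊤.  An implication u ⇨ v can only be ↑⊤
-- when v is, hence t(x,y) = ⊤⁺ outside the row x = ↑⊤ (for (1) and (2)) or the column y = ↑⊤
-- (for (3)), while it does fail somewhere.  With N = 2ⁿ + 1 elements the density thus lies in
-- [1 − 1/N, 1), and N is unbounded.

module Submission where

open import Level using (0ℓ; _⊔_)
open import Data.Fin using (Fin; zero; suc)
open import Data.Nat using (ℕ; zero; suc)
open import Data.Product using (Σ-syntax; _×_; _,_; proj₁; proj₂)
open import Function.Base using (_∘_)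
open import Function.Bundles using (Inverse)
open import Relation.Binary.PropositionalEquality as ≡ using (_≡_)
open import Relation.Nullary using (¬_; yes; no)
open import Relation.Nullary.Negation using (contradiction)
open import Relation.Binary.Core using (Rel)
open import Relation.Binary.Definitions using (Decidable)
open import Relation.Binary.Lattice.Bundles using (HeytingAlgebra; BooleanAlgebra)
open import Relation.Binary.Lattice.Definitions using (Supremum; Infimum; Exponential)
open import Relation.Binary.Structures using (IsEquivalence; IsPartialOrder)

open import Defs

module HeytingAlgebraProperties {c ℓ₁ ℓ₂} (G : HeytingAlgebra c ℓ₁ ℓ₂) where

  open HeytingAlgebra G
  open import Relation.Binary.Lattice.Properties.HeytingAlgebra G using (⇨-eval; y≤x⇨y)

  ≤⇒⇨≈⊤ : ∀ {x y} → x ≤ y → x ⇨ y ≈ ⊤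
  ≤⇒⇨≈⊤ x≤y = antisym (maximum _) (transpose-⇨ (trans (x∧y≤y _ _) x≤y))

  ⇨≈⊤⇒≤ : ∀ {x y} → x ⇨ y ≈ ⊤ → x ≤ y
  ⇨≈⊤⇒≤ {x} x⇨y≈⊤ =
    trans (∧-greatest (maximum x) refl) (transpose-∧ (reflexive (Eq.sym x⇨y≈⊤)))

  ⊤⇨x≈x : ∀ {x} → ⊤ ⇨ x ≈ x
  ⊤⇨x≈x = antisym (trans (∧-greatest refl (maximum _)) ⇨-eval) y≤x⇨y

module AdjoinTop {c ℓ₁ ℓ₂} (H : HeytingAlgebra c ℓ₁ ℓ₂)
                 (_≤?_ : Decidable (HeytingAlgebra._≤_ H)) where

  open HeytingAlgebra H
  open HeytingAlgebraProperties H
  open import Relation.Binary.Lattice.Properties.HeytingAlgebra H using (⇨-cong)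

  infix  4 _≈⁺_ _≤⁺_
  infixr 5 _⇨⁺_
  infixr 6 _∨⁺_
  infixr 7 _∧⁺_

  data Carrier⁺ : Set c where
    ⊤⁺ : Carrier⁺
    ↑_ : Carrier → Carrier⁺

  data _≈⁺_ : Rel Carrier⁺ (c ⊔ ℓ₁) where
    ⊤⁺≈⊤⁺ : ⊤⁺ ≈⁺ ⊤⁺
    ↑≈↑   : ∀ {a b} → a ≈ b → ↑ a ≈⁺ ↑ b

  data _≤⁺_ : Rel Carrier⁺ (c ⊔ ℓ₂) where
    u≤⊤⁺ : ∀ {u} → u ≤⁺ ⊤⁺
    ↑≤↑  : ∀ {a b} → a ≤ b → ↑ a ≤⁺ ↑ b

  _∧⁺_ : Carrier⁺ → Carrier⁺ → Carrier⁺
  ⊤⁺  ∧⁺ v   = v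
  ↑ a ∧⁺ ⊤⁺  = ↑ a
  ↑ a ∧⁺ ↑ b = ↑ (a ∧ b)

  _∨⁺_ : Carrier⁺ → Carrier⁺ → Carrier⁺
  ⊤⁺  ∨⁺ _   = ⊤⁺
  ↑ a ∨⁺ ⊤⁺  = ⊤⁺
  ↑ a ∨⁺ ↑ b = ↑ (a ∨ b)

  _⇨⁺_ : Carrier⁺ → Carrier⁺ → Carrier⁺
  ⊤⁺  ⇨⁺ v  = v
  ↑ a ⇨⁺ ⊤⁺ = ⊤⁺
  ↑ a ⇨⁺ ↑ b with a ≤? b
  ... | yes _ = ⊤⁺
  ... | no  _ = ↑ (a ⇨ b)

  ≈⁺-isEquivalence : IsEquivalence _≈⁺_
  ≈⁺-isEquivalence = record { refl = ≈⁺-refl ; sym = ≈⁺-sym ; trans = ≈⁺-trans }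
    where
    ≈⁺-refl : ∀ {u} → u ≈⁺ u
    ≈⁺-refl {⊤⁺}  = ⊤⁺≈⊤⁺
    ≈⁺-refl {↑ _} = ↑≈↑ Eq.refl
    ≈⁺-sym : ∀ {u v} → u ≈⁺ v → v ≈⁺ u
    ≈⁺-sym ⊤⁺≈⊤⁺   = ⊤⁺≈⊤⁺
    ≈⁺-sym (↑≈↑ p) = ↑≈↑ (Eq.sym p)
    ≈⁺-trans : ∀ {u v w} → u ≈⁺ v → v ≈⁺ w → u ≈⁺ w
    ≈⁺-trans ⊤⁺≈⊤⁺   ⊤⁺≈⊤⁺   = ⊤⁺≈⊤⁺
    ≈⁺-trans (↑≈↑ p) (↑≈↑ q) = ↑≈↑ (Eq.trans p q)

  ≤⁺-refl : ∀ {u} → u ≤⁺ u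
  ≤⁺-refl {⊤⁺}  = u≤⊤⁺
  ≤⁺-refl {↑ _} = ↑≤↑ refl

  ≤⁺-isPartialOrder : IsPartialOrder _≈⁺_ _≤⁺_
  ≤⁺-isPartialOrder = record
    { isPreorder = record
      { isEquivalence = ≈⁺-isEquivalence
      ; reflexive     = λ { ⊤⁺≈⊤⁺ → u≤⊤⁺ ; (↑≈↑ p) → ↑≤↑ (reflexive p) }
      ; trans         = ≤⁺-trans
      }
    ; antisym = λ { u≤⊤⁺ u≤⊤⁺ → ⊤⁺≈⊤⁺ ; (↑≤↑ p) (↑≤↑ q) → ↑≈↑ (antisym p q) }
    }
    where
    ≤⁺-trans : ∀ {u v w} → u ≤⁺ v → v ≤⁺ w → u ≤⁺ w
    ≤⁺-trans _       u≤⊤⁺    = u≤⊤⁺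
    ≤⁺-trans (↑≤↑ p) (↑≤↑ q) = ↑≤↑ (trans p q)

  ∨⁺-supremum : Supremum _≤⁺_ _∨⁺_
  ∨⁺-supremum ⊤⁺    _     = u≤⊤⁺ , u≤⊤⁺ , λ _ ⊤⁺≤w _ → ⊤⁺≤w
  ∨⁺-supremum (↑ a) ⊤⁺    = u≤⊤⁺ , u≤⊤⁺ , λ _ _ ⊤⁺≤w → ⊤⁺≤w
  ∨⁺-supremum (↑ a) (↑ b) = ↑≤↑ (x≤x∨y a b) , ↑≤↑ (y≤x∨y a b) , least
    where
    least : ∀ w → ↑ a ≤⁺ w → ↑ b ≤⁺ w → ↑ (a ∨ b) ≤⁺ w
    least ⊤⁺    _       _       = u≤⊤⁺
    least (↑ _) (↑≤↑ p) (↑≤↑ q) = ↑≤↑ (∨-least p q)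

  ∧⁺-infimum : Infimum _≤⁺_ _∧⁺_
  ∧⁺-infimum ⊤⁺    _     = u≤⊤⁺ , ≤⁺-refl , λ _ _ w≤v → w≤v
  ∧⁺-infimum (↑ a) ⊤⁺    = ≤⁺-refl , u≤⊤⁺ , λ _ w≤u _ → w≤u
  ∧⁺-infimum (↑ a) (↑ b) = ↑≤↑ (x∧y≤x a b) , ↑≤↑ (x∧y≤y a b) , greatest
    where
    greatest : ∀ w → w ≤⁺ ↑ a → w ≤⁺ ↑ b → w ≤⁺ ↑ (a ∧ b)
    greatest (↑ _) (↑≤↑ p) (↑≤↑ q) = ↑≤↑ (∧-greatest p q)

  ⇨⁺-exponential : Exponential _≤⁺_ _∧⁺_ _⇨⁺_
  ⇨⁺-exponential ⊤⁺    ⊤⁺    _     = (λ p → p) , (λ p → p)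
  ⇨⁺-exponential (↑ _) ⊤⁺    _     = (λ p → p) , (λ p → p)
  ⇨⁺-exponential _     (↑ _) ⊤⁺    = (λ _ → u≤⊤⁺) , (λ _ → u≤⊤⁺)
  ⇨⁺-exponential w     (↑ a) (↑ b) with a ≤? b
  ⇨⁺-exponential ⊤⁺    (↑ a) (↑ b) | yes a≤b = (λ _ → u≤⊤⁺) , (λ _ → ↑≤↑ a≤b)
  ⇨⁺-exponential (↑ d) (↑ a) (↑ b) | yes a≤b =
    (λ _ → u≤⊤⁺) , (λ _ → ↑≤↑ (trans (x∧y≤y d a) a≤b))
  ⇨⁺-exponential ⊤⁺    (↑ a) (↑ b) | no a≰b  =
    (λ { (↑≤↑ a≤b) → contradiction a≤b a≰b }) , (λ ())
  ⇨⁺-exponential (↑ d) (↑ a) (↑ b) | no _    =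
    (λ { (↑≤↑ p) → ↑≤↑ (transpose-⇨ p) }) , (λ { (↑≤↑ p) → ↑≤↑ (transpose-∧ p) })

  heytingAlgebra⁺ : HeytingAlgebra c (c ⊔ ℓ₁) (c ⊔ ℓ₂)
  heytingAlgebra⁺ = record
    { Carrier = Carrier⁺ ; _≈_ = _≈⁺_ ; _≤_ = _≤⁺_
    ; _∨_ = _∨⁺_ ; _∧_ = _∧⁺_ ; _⇨_ = _⇨⁺_ ; ⊤ = ⊤⁺ ; ⊥ = ↑ ⊥
    ; isHeytingAlgebra = record
      { isBoundedLattice = record
        { isLattice = record
          { isPartialOrder = ≤⁺-isPartialOrder
          ; supremum       = ∨⁺-supremum
          ; infimum        = ∧⁺-infimum
          }
        ; maximum = λ _ → u≤⊤⁺
        ; minimum = λ { ⊤⁺ → u≤⊤⁺ ; (↑ a) → ↑≤↑ (minimum a) }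
        }
      ; exponential = ⇨⁺-exponential
      }
    }

  enum⁺ : ∀ {k} → Inverse (≡.setoid (Fin k)) setoid →
            Inverse (≡.setoid (Fin (suc k))) (HeytingAlgebra.setoid heytingAlgebra⁺)
  enum⁺ {k} enum = record
    { to        = to⁺
    ; from      = from⁺
    ; to-cong   = λ { ≡.refl → IsEquivalence.refl ≈⁺-isEquivalence }
    ; from-cong = from⁺-cong
    ; inverse   = inverseˡ⁺ , inverseʳ⁺
    }
    where
    open Inverse enum
    to⁺ : Fin (suc k) → Carrier⁺
    to⁺ zero    = ⊤⁺
    to⁺ (suc i) = ↑ to i
    from⁺ : Carrier⁺ → Fin (suc k)
    from⁺ ⊤⁺    = zero
    from⁺ (↑ a) = suc (from a)
    from⁺-cong : ∀ {u v} → u ≈⁺ v → from⁺ u ≡ from⁺ v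
    from⁺-cong ⊤⁺≈⊤⁺   = ≡.refl
    from⁺-cong (↑≈↑ p) = ≡.cong suc (from-cong p)
    inverseˡ⁺ : ∀ {u i} → i ≡ from⁺ u → to⁺ i ≈⁺ u
    inverseˡ⁺ {⊤⁺}  ≡.refl = ⊤⁺≈⊤⁺
    inverseˡ⁺ {↑ a} ≡.refl = ↑≈↑ (strictlyInverseˡ a)
    inverseʳ⁺ : ∀ {i u} → u ≈⁺ to⁺ i → from⁺ u ≡ i
    inverseʳ⁺ {zero}  ⊤⁺≈⊤⁺   = ≡.refl
    inverseʳ⁺ {suc _} (↑≈↑ p) = ≡.cong suc (inverseʳ p)

  ↑⇨↑-≤ : ∀ {a b} → a ≤ b → ↑ a ⇨⁺ ↑ b ≡ ⊤⁺
  ↑⇨↑-≤ {a} {b} a≤b with a ≤? b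
  ... | yes _   = ≡.refl
  ... | no  a≰b = contradiction a≤b a≰b

  ↑⇨↑-≰ : ∀ {a b} → ¬ a ≤ b → ↑ a ⇨⁺ ↑ b ≡ ↑ (a ⇨ b)
  ↑⇨↑-≰ {a} {b} a≰b with a ≤? b
  ... | yes a≤b = contradiction a≤b a≰b
  ... | no  _   = ≡.refl

  collapse : Carrier⁺ → Carrier
  collapse ⊤⁺    = ⊤
  collapse (↑ a) = a

  collapse-⇨ : ∀ u v → collapse (u ⇨⁺ v) ≈ collapse u ⇨ collapse v
  collapse-⇨ ⊤⁺    _     = Eq.sym ⊤⇨x≈x
  collapse-⇨ (↑ a) ⊤⁺    = Eq.sym (≤⇒⇨≈⊤ (maximum a))
  collapse-⇨ (↑ a) (↑ b) with a ≤? b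
  ... | yes a≤b = Eq.sym (≤⇒⇨≈⊤ a≤b)
  ... | no  _   = Eq.refl

  collapse-⇨-cong : ∀ u v {a b} → collapse u ≈ a → collapse v ≈ b → collapse (u ⇨⁺ v) ≈ a ⇨ b
  collapse-⇨-cong u v p q = Eq.trans (collapse-⇨ u v) (⇨-cong p q)

  ⇨⁺≈↑⊤⇒≈↑⊤ : ∀ u v → u ⇨⁺ v ≈⁺ ↑ ⊤ → v ≈⁺ ↑ ⊤
  ⇨⁺≈↑⊤⇒≈↑⊤ ⊤⁺    _     eq = eq
  ⇨⁺≈↑⊤⇒≈↑⊤ (↑ a) (↑ b) eq with a ≤? b | eq
  ... | no a≰b | ↑≈↑ a⇨b≈⊤ = contradiction (⇨≈⊤⇒≤ a⇨b≈⊤) a≰b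

  collapse≈⊤⇒⇨⁺≈⊤⁺ : ∀ u v → collapse (u ⇨⁺ v) ≈ ⊤ → ¬ v ≈⁺ ↑ ⊤ → u ⇨⁺ v ≈⁺ ⊤⁺
  collapse≈⊤⇒⇨⁺≈⊤⁺ u v u⇨v≈⊤ v≉↑⊤ = collapse≈⊤ (u ⇨⁺ v) u⇨v≈⊤ (v≉↑⊤ ∘ ⇨⁺≈↑⊤⇒≈↑⊤ u v)
    where
    collapse≈⊤ : ∀ w → collapse w ≈ ⊤ → ¬ w ≈⁺ ↑ ⊤ → w ≈⁺ ⊤⁺
    collapse≈⊤ ⊤⁺    _   _    = ⊤⁺≈⊤⁺
    collapse≈⊤ (↑ _) a≈⊤ w≉↑⊤ = contradiction (↑≈↑ a≈⊤) w≉↑⊤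

module AdjoinTopEquations (H : HeytingAlgebra 0ℓ 0ℓ 0ℓ)
                          (_≤?_ : Decidable (HeytingAlgebra._≤_ H)) where

  open HeytingAlgebra H
  open HeytingAlgebraProperties H using (⊤⇨x≈x)
  open AdjoinTop H _≤?_

  collapse-peirce : ∀ x y →
    collapse (peirce heytingAlgebra⁺ x y) ≈ peirce H (collapse x) (collapse y)
  collapse-peirce x y =
    collapse-⇨-cong ((x ⇨⁺ y) ⇨⁺ x) x (collapse-⇨-cong (x ⇨⁺ y) x (collapse-⇨ x y) Eq.refl) Eq.refl

  collapse-contraposition : ∀ x y →
    collapse (contraposition heytingAlgebra⁺ x y) ≈ contraposition H (collapse x) (collapse y)
  collapse-contraposition x y =
    collapse-⇨-cong ((x ⇨⁺ ↑ ⊥) ⇨⁺ (y ⇨⁺ ↑ ⊥)) (y ⇨⁺ x)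
      (collapse-⇨-cong (x ⇨⁺ ↑ ⊥) (y ⇨⁺ ↑ ⊥) (collapse-⇨ x (↑ ⊥)) (collapse-⇨ y (↑ ⊥)))
      (collapse-⇨ y x)

  collapse-casesEq : ∀ x y →
    collapse (casesEq heytingAlgebra⁺ x y) ≈ casesEq H (collapse x) (collapse y)
  collapse-casesEq x y =
    collapse-⇨-cong ((x ⇨⁺ ↑ ⊥) ⇨⁺ y) ((x ⇨⁺ y) ⇨⁺ y)
      (collapse-⇨-cong (x ⇨⁺ ↑ ⊥) y (collapse-⇨ x (↑ ⊥)) Eq.refl)
      (collapse-⇨-cong (x ⇨⁺ y) y (collapse-⇨ x y) Eq.refl)

  peirce⁺≈⊤⁺ : (∀ a b → peirce H a b ≈ ⊤) → ∀ x y → ¬ x ≈⁺ ↑ ⊤ → peirce heytingAlgebra⁺ x y ≈⁺ ⊤⁺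
  peirce⁺≈⊤⁺ valid x y x≉↑⊤ =
    collapse≈⊤⇒⇨⁺≈⊤⁺ ((x ⇨⁺ y) ⇨⁺ x) x (Eq.trans (collapse-peirce x y) (valid _ _)) x≉↑⊤

  contraposition⁺≈⊤⁺ : (∀ a b → contraposition H a b ≈ ⊤) →
                    ∀ x y → ¬ x ≈⁺ ↑ ⊤ → contraposition heytingAlgebra⁺ x y ≈⁺ ⊤⁺
  contraposition⁺≈⊤⁺ valid x y x≉↑⊤ =
    collapse≈⊤⇒⇨⁺≈⊤⁺ ((x ⇨⁺ ↑ ⊥) ⇨⁺ (y ⇨⁺ ↑ ⊥)) (y ⇨⁺ x)
      (Eq.trans (collapse-contraposition x y) (valid _ _))
      (x≉↑⊤ ∘ ⇨⁺≈↑⊤⇒≈↑⊤ y x)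

  casesEq⁺≈⊤⁺ : (∀ a b → casesEq H a b ≈ ⊤) → ∀ x y → ¬ y ≈⁺ ↑ ⊤ → casesEq heytingAlgebra⁺ x y ≈⁺ ⊤⁺
  casesEq⁺≈⊤⁺ valid x y y≉↑⊤ =
    collapse≈⊤⇒⇨⁺≈⊤⁺ ((x ⇨⁺ ↑ ⊥) ⇨⁺ y) ((x ⇨⁺ y) ⇨⁺ y) (Eq.trans (collapse-casesEq x y) (valid _ _))
      (y≉↑⊤ ∘ ⇨⁺≈↑⊤⇒≈↑⊤ (x ⇨⁺ y) y)

  module _ (⊤≰⊥ : ¬ ⊤ ≤ ⊥) where

    private
      ¬⁺↑⊤ : ↑ ⊤ ⇨⁺ ↑ ⊥ ≡ ↑ (⊤ ⇨ ⊥)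
      ¬⁺↑⊤ = ↑⇨↑-≰ ⊤≰⊥

      ↑¬⊤⇨↑ : ∀ b → ↑ (⊤ ⇨ ⊥) ⇨⁺ ↑ b ≡ ⊤⁺
      ↑¬⊤⇨↑ b = ↑⇨↑-≤ (trans (reflexive ⊤⇨x≈x) (minimum b))

    peirce⁺-↑⊤-↑⊥≡↑⊤ : peirce heytingAlgebra⁺ (↑ ⊤) (↑ ⊥) ≡ ↑ ⊤
    peirce⁺-↑⊤-↑⊥≡↑⊤ = begin
      ((↑ ⊤ ⇨⁺ ↑ ⊥) ⇨⁺ ↑ ⊤) ⇨⁺ ↑ ⊤   ≡⟨ ≡.cong (λ w → (w ⇨⁺ ↑ ⊤) ⇨⁺ ↑ ⊤) ¬⁺↑⊤ ⟩
      (↑ (⊤ ⇨ ⊥) ⇨⁺ ↑ ⊤) ⇨⁺ ↑ ⊤      ≡⟨ ≡.cong (_⇨⁺ ↑ ⊤) (↑¬⊤⇨↑ ⊤) ⟩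
      ⊤⁺ ⇨⁺ ↑ ⊤                      ∎
      where open ≡.≡-Reasoning

    contraposition⁺-↑⊤-⊤⁺≡↑⊤ : contraposition heytingAlgebra⁺ (↑ ⊤) ⊤⁺ ≡ ↑ ⊤
    contraposition⁺-↑⊤-⊤⁺≡↑⊤ = begin
      ((↑ ⊤ ⇨⁺ ↑ ⊥) ⇨⁺ ↑ ⊥) ⇨⁺ ↑ ⊤   ≡⟨ ≡.cong (λ w → (w ⇨⁺ ↑ ⊥) ⇨⁺ ↑ ⊤) ¬⁺↑⊤ ⟩
      (↑ (⊤ ⇨ ⊥) ⇨⁺ ↑ ⊥) ⇨⁺ ↑ ⊤      ≡⟨ ≡.cong (_⇨⁺ ↑ ⊤) (↑¬⊤⇨↑ ⊥) ⟩
      ⊤⁺ ⇨⁺ ↑ ⊤                      ∎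
      where open ≡.≡-Reasoning

    casesEq⁺-↑⊤-↑⊤≡↑⊤ : casesEq heytingAlgebra⁺ (↑ ⊤) (↑ ⊤) ≡ ↑ ⊤
    casesEq⁺-↑⊤-↑⊤≡↑⊤ = begin
      ((↑ ⊤ ⇨⁺ ↑ ⊥) ⇨⁺ ↑ ⊤) ⇨⁺ ((↑ ⊤ ⇨⁺ ↑ ⊤) ⇨⁺ ↑ ⊤)
        ≡⟨ ≡.cong₂ (λ w z → (w ⇨⁺ ↑ ⊤) ⇨⁺ (z ⇨⁺ ↑ ⊤)) ¬⁺↑⊤ (↑⇨↑-≤ refl) ⟩
      (↑ (⊤ ⇨ ⊥) ⇨⁺ ↑ ⊤) ⇨⁺ (⊤⁺ ⇨⁺ ↑ ⊤)
        ≡⟨ ≡.cong (_⇨⁺ ↑ ⊤) (↑¬⊤⇨↑ ⊤) ⟩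
      ⊤⁺ ⇨⁺ ↑ ⊤
        ∎
      where open ≡.≡-Reasoning

open import Data.Bool using (true; false)
open import Data.Fin using (_≟_)
open import Data.List using (List; []; _∷_; _++_; length; filter; map; cartesianProduct; allFin)
open import Data.List.Properties
  using (length-++; length-map; length-tabulate; filter-++; filter-all; filter-none; filter-notAll)
open import Data.List.Membership.Propositional using (_∈_; lose)
open import Data.List.Membership.Propositional.Properties using (∈-cartesianProduct⁺; ∈-allFin)
open import Data.List.Relation.Unary.All using (All; _∷_)
import Data.List.Relation.Unary.All as All
import Data.List.Relation.Unary.All.Properties as Allₚ
open import Data.List.Relation.Unary.AllPairs using (_∷_)
open import Data.List.Relation.Unary.Unique.Propositional using (Unique)
import Data.List.Relation.Unary.Unique.Propositional.Properties as Unique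
open import Data.Nat using (_+_; _*_; _≤_; _<_; z≤n; s≤s)
open import Data.Nat.Properties
  using (≤-reflexive; ≤-trans; <-trans; <-irrefl; <⇒≱; n≤1+n; n<1+n; m<n⇒m<1+n; m<m+n; +-suc;
         +-identityʳ; +-monoʳ-≤; +-cancelˡ-≤; *-mono-≤; *-monoʳ-≤; *-monoˡ-<; *-identityˡ;
         *-identityʳ; *-distribˡ-+; m≤n*m; m^n>0; module ≤-Reasoning)
open import Relation.Binary.Definitions using (DecidableEquality)
open import Relation.Nullary using (does)
open import Relation.Unary using (Pred)
import Relation.Unary as Unary

private
  variable
    A B : Set

length-cartesianProduct : ∀ (xs : List A) (ys : List B) →
                          length (cartesianProduct xs ys) ≡ length xs * length ys
length-cartesianProduct []       ys = ≡.refl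
length-cartesianProduct (x ∷ xs) ys = begin
  length (map (x ,_) ys ++ cartesianProduct xs ys)     ≡⟨ length-++ (map (x ,_) ys) ⟩
  length (map (x ,_) ys) + length (cartesianProduct xs ys)
    ≡⟨ ≡.cong₂ _+_ (length-map (x ,_) ys) (length-cartesianProduct xs ys) ⟩
  length ys + length xs * length ys                     ∎
  where open ≡.≡-Reasoning

module _ {p q} {P : Pred A p} {Q : Pred A q} (P? : Unary.Decidable P) (Q? : Unary.Decidable Q) where

  length≤length-filter+length-filter : (∀ x → ¬ P x → Q x) → ∀ xs →
    length xs ≤ length (filter P? xs) + length (filter Q? xs)
  length≤length-filter+length-filter ¬P⇒Q []       = z≤n
  length≤length-filter+length-filter ¬P⇒Q (x ∷ xs)
    with ih ← length≤length-filter+length-filter ¬P⇒Q xs | P? x | Q? x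
  ... | yes _  | yes _  = s≤s (≤-trans ih (+-monoʳ-≤ _ (n≤1+n _)))
  ... | yes _  | no  _  = s≤s ih
  ... | no  _  | yes _  = ≤-trans (s≤s ih) (≤-reflexive (≡.sym (+-suc _ _)))
  ... | no ¬px | no ¬qx = contradiction (¬P⇒Q x ¬px) ¬qx

filter-map : ∀ {p} {P : Pred B p} (P? : Unary.Decidable P) (f : A → B) xs →
             filter P? (map f xs) ≡ map f (filter (P? ∘ f) xs)
filter-map P? f []       = ≡.refl
filter-map P? f (x ∷ xs) with does (P? (f x))
... | true  = ≡.cong (f x ∷_) (filter-map P? f xs)
... | false = filter-map P? f xs

module _ {q} {Q : Pred A q} (Q? : Unary.Decidable Q) where

  filter-proj₁-cartesianProduct : ∀ xs (ys : List B) →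
    filter (Q? ∘ proj₁) (cartesianProduct xs ys) ≡ cartesianProduct (filter Q? xs) ys
  filter-proj₁-cartesianProduct []       ys = ≡.refl
  filter-proj₁-cartesianProduct (x ∷ xs) ys
    with ih ← filter-proj₁-cartesianProduct xs ys | Q? x
  ... | yes qx = ≡.trans (filter-++ (Q? ∘ proj₁) (map (x ,_) ys) _) (≡.cong₂ _++_ row ih)
    where
    row : filter (Q? ∘ proj₁) (map (x ,_) ys) ≡ map (x ,_) ys
    row = filter-all (Q? ∘ proj₁) (Allₚ.map⁺ (All.universal (λ _ → qx) ys))
  ... | no ¬qx = ≡.trans (filter-++ (Q? ∘ proj₁) (map (x ,_) ys) _) (≡.cong₂ _++_ row ih)
    where
    row : filter (Q? ∘ proj₁) (map (x ,_) ys) ≡ []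
    row = filter-none (Q? ∘ proj₁) (Allₚ.map⁺ (All.universal (λ _ → ¬qx) ys))

module _ {q} {Q : Pred B q} (Q? : Unary.Decidable Q) where

  filter-proj₂-cartesianProduct : ∀ (xs : List A) ys →
    filter (Q? ∘ proj₂) (cartesianProduct xs ys) ≡ cartesianProduct xs (filter Q? ys)
  filter-proj₂-cartesianProduct []       ys = ≡.refl
  filter-proj₂-cartesianProduct (x ∷ xs) ys =
    ≡.trans (filter-++ (Q? ∘ proj₂) (map (x ,_) ys) _)
          (≡.cong₂ _++_ (filter-map (Q? ∘ proj₂) (x ,_) ys) (filter-proj₂-cartesianProduct xs ys))

module _ (_≟ᴬ_ : DecidableEquality A) (c : A) where

  length-filter-≟-unique : ∀ {xs} → Unique xs → length (filter (_≟ᴬ c) xs) ≤ 1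
  length-filter-≟-unique {xs} unique =
    length≤1 (Unique.filter⁺ (_≟ᴬ c) unique) (Allₚ.all-filter (_≟ᴬ c) xs)
    where
    length≤1 : ∀ {ys} → Unique ys → All (_≡ c) ys → length ys ≤ 1
    length≤1 {[]}        _               _               = z≤n
    length≤1 {_ ∷ []}    _               _               = s≤s z≤n
    length≤1 {_ ∷ _ ∷ _} ((y≢z ∷ _) ∷ _) (y≡c ∷ z≡c ∷ _) =
      contradiction (≡.trans y≡c (≡.sym z≡c)) y≢z


length-allFin : ∀ n → length (allFin n) ≡ n
length-allFin n = length-tabulate (λ i → i)

module SatCount (F : FiniteHeytingAlgebra) (t : Equation) where

  open FiniteHeytingAlgebra F using (heyting; size; enum; Carrier; _≈_; ⊤; module Eq)
  open Inverse enum using (to; from; from-cong; inverseˡ; inverseʳ; strictlyInverseˡ)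

  pairs : List (Fin size × Fin size)
  pairs = cartesianProduct (allFin size) (allFin size)

  Satisfied : Fin size × Fin size → Set
  Satisfied (i , j) = from (t heyting (to i) (to j)) ≡ from ⊤

  length-pairs : length pairs ≡ size * size
  length-pairs = ≡.trans (length-cartesianProduct (allFin size) (allFin size))
                       (≡.cong₂ _*_ (length-allFin size) (length-allFin size))

  from-injective : ∀ {x y} → from x ≡ from y → x ≈ y
  from-injective {x} eq = Eq.trans (Eq.sym (strictlyInverseˡ x)) (inverseˡ eq)

  satCount<size² : ∀ i j → ¬ t heyting (to i) (to j) ≈ ⊤ → satCount t F < size * size
  satCount<size² i j fails = begin-strict
    satCount t F  <⟨ filter-notAll _ pairs (lose ij∈pairs (fails ∘ from-injective)) ⟩
    length pairs  ≡⟨ length-pairs ⟩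
    size * size   ∎
    where
    open ≤-Reasoning
    ij∈pairs : (i , j) ∈ pairs
    ij∈pairs = ∈-cartesianProduct⁺ (∈-allFin i) (∈-allFin j)

  from-to-≈ : ∀ {i x} → to i ≈ x → i ≡ from x
  from-to-≈ to-i≈x = ≡.sym (inverseʳ (Eq.sym to-i≈x))

  size²≤satCount+size : ∀ {r} {R : Pred (Fin size × Fin size) r} (R? : Unary.Decidable R) →
    (∀ ij → ¬ Satisfied ij → R ij) → length (filter R? pairs) ≤ size →
    size * size ≤ satCount t F + size
  size²≤satCount+size R? unsatisfied⇒R few-R = begin
    size * size                              ≡⟨ ≡.sym length-pairs ⟩
    length pairs                             ≤⟨ length≤length-filter+length-filter _ R? unsatisfied⇒R pairs ⟩
    satCount t F + length (filter R? pairs)  ≤⟨ +-monoʳ-≤ (satCount t F) few-R ⟩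
    satCount t F + size                      ∎
    where open ≤-Reasoning

  module _ (c : Carrier) where

    private
      count-c : length (filter (_≟ from c) (allFin size)) ≤ 1
      count-c = length-filter-≟-unique _≟_ (from c) (Unique.allFin⁺ size)

    size²≤satCount+size-row : (∀ x y → ¬ x ≈ c → t heyting x y ≈ ⊤) →
                              size * size ≤ satCount t F + size
    size²≤satCount+size-row holds =
      size²≤satCount+size ((_≟ from c) ∘ proj₁) unsatisfied⇒row row-size
      where
      unsatisfied⇒row : ∀ ij → ¬ Satisfied ij → proj₁ ij ≡ from c
      unsatisfied⇒row (i , j) unsat with i ≟ from c
      ... | yes i≡c = i≡c
      ... | no  i≢c = contradiction (from-cong (holds (to i) (to j) (i≢c ∘ from-to-≈))) unsat
      row-size : length (filter ((_≟ from c) ∘ proj₁) pairs) ≤ size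
      row-size = begin
        length (filter ((_≟ from c) ∘ proj₁) pairs)
          ≡⟨ ≡.cong length (filter-proj₁-cartesianProduct (_≟ from c) (allFin size) (allFin size)) ⟩
        length (cartesianProduct (filter (_≟ from c) (allFin size)) (allFin size))
          ≡⟨ length-cartesianProduct (filter (_≟ from c) (allFin size)) (allFin size) ⟩
        length (filter (_≟ from c) (allFin size)) * length (allFin size)
          ≤⟨ *-mono-≤ count-c (≤-reflexive (length-allFin size)) ⟩
        1 * size ≡⟨ *-identityˡ size ⟩
        size     ∎
        where open ≤-Reasoning

    size²≤satCount+size-column : (∀ x y → ¬ y ≈ c → t heyting x y ≈ ⊤) →
                                 size * size ≤ satCount t F + size
    size²≤satCount+size-column holds =
      size²≤satCount+size ((_≟ from c) ∘ proj₂) unsatisfied⇒column column-size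
      where
      unsatisfied⇒column : ∀ ij → ¬ Satisfied ij → proj₂ ij ≡ from c
      unsatisfied⇒column (i , j) unsat with j ≟ from c
      ... | yes j≡c = j≡c
      ... | no  j≢c = contradiction (from-cong (holds (to i) (to j) (j≢c ∘ from-to-≈))) unsat
      column-size : length (filter ((_≟ from c) ∘ proj₂) pairs) ≤ size
      column-size = begin
        length (filter ((_≟ from c) ∘ proj₂) pairs)
          ≡⟨ ≡.cong length (filter-proj₂-cartesianProduct (_≟ from c) (allFin size) (allFin size)) ⟩
        length (cartesianProduct (allFin size) (filter (_≟ from c) (allFin size)))
          ≡⟨ length-cartesianProduct (allFin size) (filter (_≟ from c) (allFin size)) ⟩
        length (allFin size) * length (filter (_≟ from c) (allFin size))
          ≤⟨ *-mono-≤ (≤-reflexive (length-allFin size)) count-c ⟩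
        size * 1 ≡⟨ *-identityʳ size ⟩
        size     ∎
        where open ≤-Reasoning

open import Data.Fin.Properties using (*↔×; 2↔Bool)
open import Data.Fin.Subset using (Subset; _⊆_; _∩_; _∪_; ∁; ⊤; ⊥; inside; outside)
open import Data.Fin.Subset.Properties
  using (⊆-isPartialOrder; ⊆-min; ⊆-max; _⊆?_; _∈?_; ∉⊥; ∈⊤; p⊆p∪q; q⊆p∪q; p∩q⊆p; p∩q⊆q;
         x∈p∪q⁺; x∈p∪q⁻; x∈p∩q⁺; x∈p∩q⁻; x∉p⇒x∈∁p; x∈∁p⇒x∉p)
open import Data.Nat using (_^_)
open import Data.Product using (uncurry)
open import Data.Product.Function.NonDependent.Propositional using (_×-↔_)
open import Data.Sum using (inj₁; inj₂; [_,_]′)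
open import Data.Vec using (Vec; []; _∷_)
open import Function.Bundles using (_↔_; mk↔ₛ′)
open import Function.Properties.Inverse using (↔-trans)

module _ {n : ℕ} where

  ∪-supremum : Supremum (_⊆_ {n}) _∪_
  ∪-supremum p q = p⊆p∪q q , q⊆p∪q p q , λ r p⊆r q⊆r → [ p⊆r , q⊆r ]′ ∘ x∈p∪q⁻ p q

  ∩-infimum : Infimum (_⊆_ {n}) _∩_
  ∩-infimum p q = p∩q⊆p p q , p∩q⊆q p q , λ r r⊆p r⊆q x∈r → x∈p∩q⁺ (r⊆p x∈r , r⊆q x∈r)

  ∁∪-exponential : Exponential (_⊆_ {n}) _∩_ (λ p q → ∁ p ∪ q)
  ∁∪-exponential r p q = transpose-⇨ , transpose-∧
    where
    transpose-⇨ : r ∩ p ⊆ q → r ⊆ ∁ p ∪ q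
    transpose-⇨ r∩p⊆q {x} x∈r with x ∈? p
    ... | yes x∈p = x∈p∪q⁺ (inj₂ (r∩p⊆q (x∈p∩q⁺ (x∈r , x∈p))))
    ... | no  x∉p = x∈p∪q⁺ (inj₁ (x∉p⇒x∈∁p x∉p))
    transpose-∧ : r ⊆ ∁ p ∪ q → r ∩ p ⊆ q
    transpose-∧ r⊆∁p∪q x∈r∩p with x∈r , x∈p ← x∈p∩q⁻ r p x∈r∩p =
      [ (λ x∈∁p → contradiction x∈p (x∈∁p⇒x∉p x∈∁p)) , (λ x∈q → x∈q) ]′
      (x∈p∪q⁻ (∁ p) q (r⊆∁p∪q x∈r))

subsetBooleanAlgebra : ℕ → BooleanAlgebra 0ℓ 0ℓ 0ℓ
subsetBooleanAlgebra n = record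
  { Carrier = Subset n ; _≈_ = _≡_ ; _≤_ = _⊆_ ; _∨_ = _∪_ ; _∧_ = _∩_ ; ¬_ = ∁ ; ⊤ = ⊤ ; ⊥ = ⊥
  ; isBooleanAlgebra = record
    { isHeytingAlgebra = record
      { isBoundedLattice = record
        { isLattice = record
          { isPartialOrder = ⊆-isPartialOrder n
          ; supremum       = ∪-supremum
          ; infimum        = ∩-infimum
          }
        ; maximum = ⊆-max
        ; minimum = ⊆-min
        }
      ; exponential = ∁∪-exponential
      }
    }
  }

subsetHeytingAlgebra : ℕ → HeytingAlgebra 0ℓ 0ℓ 0ℓ
subsetHeytingAlgebra n = BooleanAlgebra.heytingAlgebra (subsetBooleanAlgebra n)

peirce-valid : ∀ {n} (p q : Subset n) → peirce (subsetHeytingAlgebra n) p q ≡ ⊤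
peirce-valid []            []        = ≡.refl
peirce-valid (inside  ∷ p) (inside  ∷ q) = ≡.cong (inside ∷_) (peirce-valid p q)
peirce-valid (inside  ∷ p) (outside ∷ q) = ≡.cong (inside ∷_) (peirce-valid p q)
peirce-valid (outside ∷ p) (inside  ∷ q) = ≡.cong (inside ∷_) (peirce-valid p q)
peirce-valid (outside ∷ p) (outside ∷ q) = ≡.cong (inside ∷_) (peirce-valid p q)

contraposition-valid : ∀ {n} (p q : Subset n) → contraposition (subsetHeytingAlgebra n) p q ≡ ⊤
contraposition-valid []            []            = ≡.refl
contraposition-valid (inside  ∷ p) (inside  ∷ q) = ≡.cong (inside ∷_) (contraposition-valid p q)
contraposition-valid (inside  ∷ p) (outside ∷ q) = ≡.cong (inside ∷_) (contraposition-valid p q)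
contraposition-valid (outside ∷ p) (inside  ∷ q) = ≡.cong (inside ∷_) (contraposition-valid p q)
contraposition-valid (outside ∷ p) (outside ∷ q) = ≡.cong (inside ∷_) (contraposition-valid p q)

casesEq-valid : ∀ {n} (p q : Subset n) → casesEq (subsetHeytingAlgebra n) p q ≡ ⊤
casesEq-valid []            []            = ≡.refl
casesEq-valid (inside  ∷ p) (inside  ∷ q) = ≡.cong (inside ∷_) (casesEq-valid p q)
casesEq-valid (inside  ∷ p) (outside ∷ q) = ≡.cong (inside ∷_) (casesEq-valid p q)
casesEq-valid (outside ∷ p) (inside  ∷ q) = ≡.cong (inside ∷_) (casesEq-valid p q)
casesEq-valid (outside ∷ p) (outside ∷ q) = ≡.cong (inside ∷_) (casesEq-valid p q)

×↔Vec-suc : ∀ {a} {A : Set a} {n} → (A × Vec A n) ↔ Vec A (suc n)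
×↔Vec-suc = mk↔ₛ′ (uncurry _∷_) (λ { (x ∷ xs) → x , xs }) (λ { (_ ∷ _) → ≡.refl }) (λ _ → ≡.refl)

subset↔ : ∀ n → Fin (2 ^ n) ↔ Subset n
subset↔ zero    = mk↔ₛ′ (λ _ → []) (λ _ → zero) (λ { [] → ≡.refl }) (λ { zero → ≡.refl })
subset↔ (suc n) = ↔-trans *↔× (↔-trans (2↔Bool ×-↔ subset↔ n) ×↔Vec-suc)

n<2^n : ∀ n → n < 2 ^ n
n<2^n zero    = s≤s z≤n
n<2^n (suc n) = begin-strict
  suc n          ≤⟨ n<2^n n ⟩
  2 ^ n          <⟨ m<m+n (2 ^ n) (m^n>0 2 n) ⟩
  2 ^ n + 2 ^ n  ≡⟨ ≡.cong (2 ^ n +_) (≡.sym (+-identityʳ (2 ^ n))) ⟩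
  2 ^ suc n      ∎
  where open ≤-Reasoning

q*s+p*n²≰q*n² : ∀ {p q n s} → 0 < p → q < n → n * n ≤ s + n → ¬ q * s + p * (n * n) ≤ q * (n * n)
q*s+p*n²≰q*n² {p@(suc _)} {q} {n@(suc _)} {s} _ q<n n²≤s+n gapped = <⇒≱ (*-monoˡ-< n q<n) n²≤q*n
  where
  p*n²≤q*n : p * (n * n) ≤ q * n
  p*n²≤q*n = +-cancelˡ-≤ (q * s) _ _ (begin
    q * s + p * (n * n)  ≤⟨ gapped ⟩
    q * (n * n)          ≤⟨ *-monoʳ-≤ q n²≤s+n ⟩
    q * (s + n)          ≡⟨ *-distribˡ-+ q s n ⟩
    q * s + q * n        ∎)
    where open ≤-Reasoning
  n²≤q*n : n * n ≤ q * n
  n²≤q*n = ≤-trans (m≤n*m (n * n) p) p*n²≤q*n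

AlmostValid : Equation → FiniteHeytingAlgebra → Set
AlmostValid t F = satCount t F < n * n × n * n ≤ satCount t F + n
  where n = FiniteHeytingAlgebra.size F

¬HasFiniteSatGap : ∀ t →
  (∀ q → Σ[ F ∈ FiniteHeytingAlgebra ] q < FiniteHeytingAlgebra.size F × AlmostValid t F) →
  ¬ HasFiniteSatGap t
¬HasFiniteSatGap t family (p , q , 0<p , _ , gap) with family q
... | F , q<n , sat<n² , n²≤sat+n with gap F
...   | inj₁ sat≡n² = <-irrefl sat≡n² sat<n²
...   | inj₂ gapped = q*s+p*n²≰q*n² 0<p q<n n²≤sat+n gapped

subsets⊕1 : ℕ → FiniteHeytingAlgebra
subsets⊕1 n = record { heyting = heytingAlgebra⁺ ; size = suc (2 ^ n) ; enum = enum⁺ (subset↔ n) }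
  where open AdjoinTop (subsetHeytingAlgebra n) _⊆?_

module _ (m : ℕ) where

  private
    n : ℕ
    n = suc m

    F : FiniteHeytingAlgebra
    F = subsets⊕1 n

  open AdjoinTop (subsetHeytingAlgebra n) _⊆?_ using (heytingAlgebra⁺; ⊤⁺; ↑_; _≈⁺_; ⊤⁺≈⊤⁺; ↑≈↑)
  open AdjoinTopEquations (subsetHeytingAlgebra n) _⊆?_
  open Inverse (FiniteHeytingAlgebra.enum F) using (to; from; strictlyInverseˡ)

  private
    ⊤⊈⊥ : ¬ ⊤ ⊆ ⊥ {n}
    ⊤⊈⊥ ⊤⊆⊥ = ∉⊥ (⊤⊆⊥ (∈⊤ {x = zero}))

    ≈⁺⇒≡ : ∀ {u v} → u ≈⁺ v → u ≡ v
    ≈⁺⇒≡ ⊤⁺≈⊤⁺   = ≡.refl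
    ≈⁺⇒≡ (↑≈↑ p) = ≡.cong ↑_ p

    -- An Equation need not respect ≈⁺, so the failing pair is transported along ≡.
    fails-at : ∀ (t : Equation) u v → t heytingAlgebra⁺ u v ≡ ↑ ⊤ →
               ¬ t heytingAlgebra⁺ (to (from u)) (to (from v)) ≈⁺ ⊤⁺
    fails-at t u v t≡↑⊤ rewrite ≈⁺⇒≡ (strictlyInverseˡ u) | ≈⁺⇒≡ (strictlyInverseˡ v) | t≡↑⊤ = λ ()

  peirce-almostValid : AlmostValid peirce F
  peirce-almostValid =
    satCount<size² (from (↑ ⊤)) (from (↑ ⊥))
      (fails-at peirce (↑ ⊤) (↑ ⊥) (peirce⁺-↑⊤-↑⊥≡↑⊤ ⊤⊈⊥)) ,
    size²≤satCount+size-row (↑ ⊤) (peirce⁺≈⊤⁺ peirce-valid)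
    where open SatCount F peirce

  contraposition-almostValid : AlmostValid contraposition F
  contraposition-almostValid =
    satCount<size² (from (↑ ⊤)) (from ⊤⁺)
      (fails-at contraposition (↑ ⊤) ⊤⁺ (contraposition⁺-↑⊤-⊤⁺≡↑⊤ ⊤⊈⊥)) ,
    size²≤satCount+size-row (↑ ⊤) (contraposition⁺≈⊤⁺ contraposition-valid)
    where open SatCount F contraposition

  casesEq-almostValid : AlmostValid casesEq F
  casesEq-almostValid =
    satCount<size² (from (↑ ⊤)) (from (↑ ⊤))
      (fails-at casesEq (↑ ⊤) (↑ ⊤) (casesEq⁺-↑⊤-↑⊤≡↑⊤ ⊤⊈⊥)) ,
    size²≤satCount+size-column (↑ ⊤) (casesEq⁺≈⊤⁺ casesEq-valid)
    where open SatCount F casesEq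

  m<size : m < FiniteHeytingAlgebra.size F
  m<size = m<n⇒m<1+n (<-trans (n<1+n m) (n<2^n n))

corollary3p11 : ¬ HasFiniteSatGap peirce × ¬ HasFiniteSatGap contraposition × ¬ HasFiniteSatGap casesEq
corollary3p11 =
  ¬HasFiniteSatGap peirce (λ q → subsets⊕1 (suc q) , m<size q , peirce-almostValid q) ,
  ¬HasFiniteSatGap contraposition
    (λ q → subsets⊕1 (suc q) , m<size q , contraposition-almostValid q) ,
  ¬HasFiniteSatGap casesEq (λ q → subsets⊕1 (suc q) , m<size q , casesEq-almostValid q)
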